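{- Let $\{A_n\}_{n\ge0}$ be an even sequence, and let $l\ge1$ be an integer such that $A_0=A_1=\cdots=A_{l-1}=0$ and $A_l\neq0$. Then the sequence $$\Big\{\frac{A_{n+l}}{(n+1)(n+2)\cdots(n+l)}\Big\}_{n\ge0}$$ is an even sequence.
   Context: A sequence $\{a_n\}_{n\ge0}$ of real (or complex) numbers is called an even sequence if $\sum_{k=0}^n\binom nk(-1)^ka_k=a_n$ for all $n=0,1,2,\ldots$. -}

module Defs where

open import Level using (Level; _⊔_) renaming (suc to lsuc)
open import Algebra.Bundles using (CommutativeRing)
open import Data.Nat using (ℕ; zero; suc) renaming (_+_ to _+ℕ_)
open import Data.Nat.Combinatorics using (_C_)
open import Relation.Nullary using (¬_)

module RingOps {c ℓ : Level} (R : CommutativeRing c ℓ) where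
  open CommutativeRing R

  ι : ℕ → Carrier
  ι zero    = 0#
  ι (suc n) = 1# + ι n

  sgn : ℕ → Carrier
  sgn zero    = 1#
  sgn (suc k) = - sgn k

  sumTo : ℕ → (ℕ → Carrier) → Carrier
  sumTo zero    f = f 0
  sumTo (suc n) f = sumTo n f + f (suc n)

  IsEven : (ℕ → Carrier) → Set ℓ
  IsEven a = ∀ n → sumTo n (λ k → ι (n C k) * (sgn k * a k)) ≈ a n

  rise : ℕ → ℕ → Carrier
  rise n zero    = 1#
  rise n (suc l) = rise n l * ι (n +ℕ suc l)

-- A field of characteristic zero (e.g. ℝ or ℂ): a commutative ring with a
-- (total) inverse operation that inverts every nonzero element, in which
-- 1 + ... + 1 (n+1 times) is never zero.
record CharZeroField (c ℓ : Level) : Set (lsuc (c ⊔ ℓ)) where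
  field
    commutativeRing : CommutativeRing c ℓ
  open CommutativeRing commutativeRing public
  open RingOps commutativeRing public
  field
    _⁻¹        : Carrier → Carrier
    ⁻¹-inverse : ∀ x → ¬ (x ≈ 0#) → x * (x ⁻¹) ≈ 1#
    char-zero  : ∀ n → ¬ (ι (suc n) ≈ 0#)

module Submission where

-- Write  r(n,l) = (n+1)(n+2)⋯(n+l)  and  b n = A (n+l) / r(n,l).
--
-- Evenness of A at index n+l, together with A k = 0 for k < l, gives
--   A (n+l) = Σ_{k≤n} C(n+l,k+l) (-1)^(k+l) A (k+l).
-- Evenness at index l alone gives (-1)^l A l = A l, so (-1)^l = 1 because
-- A l ≠ 0 and 2 is invertible.  Substituting A (k+l) = r(k,l) b k and using
-- the integer identity
--   C(n+l,k+l) · r(k,l) = r(n,l) · C(n,k)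
-- turns the sum into  r(n,l) · Σ_{k≤n} C(n,k) (-1)^k b k ;  dividing by the
-- nonzero r(n,l) is evenness of b at n.

open import Defs
open import Level using (Level)
open import Data.Nat using (ℕ; _≤_; _<_) renaming (_+_ to _+ℕ_)
open import Relation.Nullary using (¬_)

module BinomialArithmetic where
  open import Data.Nat using (zero; suc; _*_; _+_)
  open import Data.Nat.Properties using (*-identityʳ; *-assoc; +-identityʳ; +-suc)
  open import Data.Nat.Combinatorics using (_C_; nC1≡n; nCk+nC[k+1]≡[n+1]C[k+1])
  open import Data.Nat.Tactic.RingSolver using (solve-∀)
  open import Data.Product using (Σ; _,_)
  open import Relation.Binary.PropositionalEquality
    using (_≡_; refl; sym; trans; cong; cong₂; module ≡-Reasoning)
  open ≡-Reasoning

  absorption : ∀ m j → (suc m C suc j) * suc j ≡ suc m * (m C j)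
  absorption zero    zero    = refl
  absorption zero    (suc j) = refl
  absorption (suc m) zero    = begin
    (suc (suc m) C 1) * 1 ≡⟨ *-identityʳ _ ⟩
    suc (suc m) C 1       ≡⟨ nC1≡n (suc (suc m)) ⟩
    suc (suc m)           ≡⟨ sym (*-identityʳ _) ⟩
    suc (suc m) * 1       ∎
  absorption (suc m) (suc i) = begin
    (suc (suc m) C suc (suc i)) * suc (suc i)
      ≡⟨ cong (_* suc (suc i)) (sym (nCk+nC[k+1]≡[n+1]C[k+1] (suc m) (suc i))) ⟩
    (a + d) * suc (suc i)               ≡⟨ expand a d i ⟩
    a * suc i + a + d * suc (suc i)
      ≡⟨ cong₂ (λ x y → x + a + y) (absorption m i) (absorption m (suc i)) ⟩
    suc m * b + a + suc m * c           ≡⟨ collect m a b c ⟩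
    suc m * (b + c) + a                 ≡⟨ cong (λ x → suc m * x + a) (nCk+nC[k+1]≡[n+1]C[k+1] m i) ⟩
    suc m * a + a                       ≡⟨ merge m a ⟩
    suc (suc m) * a                     ∎
    where
    a = suc m C suc i
    b = m C i
    c = m C suc i
    d = suc m C suc (suc i)
    expand : ∀ a d i → (a + d) * suc (suc i) ≡ a * suc i + a + d * suc (suc i)
    expand = solve-∀
    collect : ∀ m a b c → suc m * b + a + suc m * c ≡ suc m * (b + c) + a
    collect = solve-∀
    merge : ∀ m a → suc m * a + a ≡ suc (suc m) * a
    merge = solve-∀

  riseℕ : ℕ → ℕ → ℕ
  riseℕ n zero    = 1
  riseℕ n (suc l) = riseℕ n l * (n + suc l)

  riseℕ-positive : ∀ n l → Σ ℕ λ m → riseℕ n l ≡ suc m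
  riseℕ-positive n zero = 0 , refl
  riseℕ-positive n (suc l) with riseℕ-positive n l
  ... | m , eq rewrite eq | +-suc n l = _ , refl

  -- C(n+l, k+l) · (k+1)⋯(k+l) = (n+1)⋯(n+l) · C(n, k), both sides being
  -- (n+l)! / (k! (n-k)!); proved by l applications of absorption.
  shifted-binomial : ∀ n k l → ((n + l) C (k + l)) * riseℕ k l ≡ riseℕ n l * (n C k)
  shifted-binomial n k zero rewrite +-identityʳ n | +-identityʳ k =
    trans (*-identityʳ (n C k)) (sym (+-identityʳ (n C k)))
  shifted-binomial n k (suc l) rewrite +-suc n l | +-suc k l = begin
    B * (riseℕ k l * suc (k + l))       ≡⟨ rotate B (riseℕ k l) (suc (k + l)) ⟩
    (B * suc (k + l)) * riseℕ k l       ≡⟨ cong (_* riseℕ k l) (absorption (n + l) (k + l)) ⟩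
    (suc (n + l) * B′) * riseℕ k l      ≡⟨ *-assoc (suc (n + l)) B′ (riseℕ k l) ⟩
    suc (n + l) * (B′ * riseℕ k l)      ≡⟨ cong (suc (n + l) *_) (shifted-binomial n k l) ⟩
    suc (n + l) * (riseℕ n l * (n C k)) ≡⟨ swap (suc (n + l)) (riseℕ n l) (n C k) ⟩
    (riseℕ n l * suc (n + l)) * (n C k) ∎
    where
    B  = suc (n + l) C suc (k + l)
    B′ = (n + l) C (k + l)
    rotate : ∀ a b c → a * (b * c) ≡ (a * c) * b
    rotate = solve-∀
    swap : ∀ a b c → a * (b * c) ≡ (b * a) * c
    swap = solve-∀

module FieldFacts {c ℓ : Level} (F : CharZeroField c ℓ) where
  open BinomialArithmetic
  open import Data.Nat using (zero; suc; z≤n; s≤s) renaming (_*_ to _*ℕ_)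
  open import Data.Nat.Properties using (m≤n⇒m≤1+n; ≤-refl)
  open import Data.Nat.Combinatorics using (_C_; nCn≡1)
  open import Data.Product using (_,_)
  open import Data.Sum using (_⊎_; inj₁; inj₂)
  open import Relation.Nullary using (contradiction)
  import Relation.Binary.PropositionalEquality as ≡
  open CharZeroField F
  open import Algebra.Properties.Ring ring using (-‿distribˡ-*; -1*x≈-x; -‿involutive)
  open import Relation.Binary.Reasoning.Setoid setoid

  ι-+ : ∀ a b → ι (a +ℕ b) ≈ ι a + ι b
  ι-+ zero    b = sym (+-identityˡ _)
  ι-+ (suc a) b = trans (+-congˡ (ι-+ a b)) (sym (+-assoc _ _ _))

  ι-* : ∀ a b → ι (a *ℕ b) ≈ ι a * ι b
  ι-* zero    b = sym (zeroˡ _)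
  ι-* (suc a) b = begin
    ι (b +ℕ a *ℕ b)       ≈⟨ ι-+ b (a *ℕ b) ⟩
    ι b + ι (a *ℕ b)      ≈⟨ +-congˡ (ι-* a b) ⟩
    ι b + ι a * ι b       ≈⟨ +-congʳ (sym (*-identityˡ _)) ⟩
    1# * ι b + ι a * ι b  ≈⟨ sym (distribʳ _ _ _) ⟩
    (1# + ι a) * ι b      ∎

  ι-1 : ι 1 ≈ 1#
  ι-1 = +-identityʳ _

  rise≈ι-riseℕ : ∀ n l → rise n l ≈ ι (riseℕ n l)
  rise≈ι-riseℕ n zero    = sym ι-1
  rise≈ι-riseℕ n (suc l) =
    trans (*-congʳ (rise≈ι-riseℕ n l)) (sym (ι-* (riseℕ n l) (n +ℕ suc l)))

  -- In characteristic zero a product of positive integers is nonzero.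
  rise-nonzero : ∀ n l → ¬ (rise n l ≈ 0#)
  rise-nonzero n l rise≈0 with riseℕ-positive n l
  ... | m , eq =
    char-zero m (trans (sym (≡.subst (λ x → rise n l ≈ ι x) eq (rise≈ι-riseℕ n l))) rise≈0)

  shifted-binomialF : ∀ n k l →
    ι ((n +ℕ l) C (k +ℕ l)) * rise k l ≈ rise n l * ι (n C k)
  shifted-binomialF n k l = begin
    ι B * rise k l                  ≈⟨ *-congˡ (rise≈ι-riseℕ k l) ⟩
    ι B * ι (riseℕ k l)             ≈⟨ sym (ι-* B (riseℕ k l)) ⟩
    ι (B *ℕ riseℕ k l)              ≈⟨ reflexive (≡.cong ι (shifted-binomial n k l)) ⟩
    ι (riseℕ n l *ℕ (n C k))        ≈⟨ ι-* (riseℕ n l) (n C k) ⟩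
    ι (riseℕ n l) * ι (n C k)       ≈⟨ *-congʳ (sym (rise≈ι-riseℕ n l)) ⟩
    rise n l * ι (n C k)            ∎
    where B = (n +ℕ l) C (k +ℕ l)

  cancel-inverse : ∀ {r} x → ¬ (r ≈ 0#) → r * (x * (r ⁻¹)) ≈ x
  cancel-inverse {r} x r≉0 = begin
    r * (x * (r ⁻¹))  ≈⟨ *-congˡ (*-comm x _) ⟩
    r * ((r ⁻¹) * x)  ≈⟨ sym (*-assoc _ _ _) ⟩
    (r * (r ⁻¹)) * x  ≈⟨ *-congʳ (⁻¹-inverse r r≉0) ⟩
    1# * x            ≈⟨ *-identityˡ x ⟩
    x                 ∎

  cancel-nonzero : ∀ {r x} → ¬ (r ≈ 0#) → r * x ≈ 0# → x ≈ 0#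
  cancel-nonzero {r} {x} r≉0 rx≈0 = begin
    x                   ≈⟨ sym (cancel-inverse x r≉0) ⟩
    r * (x * (r ⁻¹))    ≈⟨ sym (*-assoc _ _ _) ⟩
    (r * x) * (r ⁻¹)    ≈⟨ *-congʳ rx≈0 ⟩
    0# * (r ⁻¹)         ≈⟨ zeroˡ _ ⟩
    0#                  ∎

  -- Characteristic ≠ 2: the only element equal to its negative is 0.
  self-negative⇒zero : ∀ {x} → - x ≈ x → x ≈ 0#
  self-negative⇒zero {x} -x≈x = cancel-nonzero (char-zero 1) (begin
    ι 2 * x             ≈⟨ *-congʳ (+-congˡ ι-1) ⟩
    (1# + 1#) * x       ≈⟨ distribʳ _ _ _ ⟩
    1# * x + 1# * x     ≈⟨ +-cong (*-identityˡ _) (*-identityˡ _) ⟩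
    x + x               ≈⟨ +-congˡ (sym -x≈x) ⟩
    x + - x             ≈⟨ -‿inverseʳ _ ⟩
    0#                  ∎)

  sgn-± : ∀ l → (sgn l ≈ 1#) ⊎ (sgn l ≈ - 1#)
  sgn-± zero = inj₁ refl
  sgn-± (suc l) with sgn-± l
  ... | inj₁ e = inj₂ (-‿cong e)
  ... | inj₂ e = inj₁ (trans (-‿cong e) (-‿involutive 1#))

  sgn-+ : ∀ k l → sgn (k +ℕ l) ≈ sgn k * sgn l
  sgn-+ zero    l = sym (*-identityˡ _)
  sgn-+ (suc k) l = trans (-‿cong (sgn-+ k l)) (-‿distribˡ-* _ _)

  sign-fixing⇒one : ∀ l {x} → sgn l * x ≈ x → ¬ (x ≈ 0#) → sgn l ≈ 1#
  sign-fixing⇒one l fixes x≉0 with sgn-± l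
  ... | inj₁ e = e
  ... | inj₂ e = contradiction
    (self-negative⇒zero (trans (sym (-1*x≈-x _)) (trans (*-congʳ (sym e)) fixes))) x≉0

  sum-cong : ∀ n {f g : ℕ → Carrier} → (∀ k → f k ≈ g k) → sumTo n f ≈ sumTo n g
  sum-cong zero    f≈g = f≈g 0
  sum-cong (suc n) f≈g = +-cong (sum-cong n f≈g) (f≈g (suc n))

  sum-*ˡ : ∀ n r (f : ℕ → Carrier) → sumTo n (λ k → r * f k) ≈ r * sumTo n f
  sum-*ˡ zero    r f = refl
  sum-*ˡ (suc n) r f = trans (+-congʳ (sum-*ˡ n r f)) (sym (distribˡ _ _ _))

  sum-zero : ∀ n (f : ℕ → Carrier) → (∀ k → k ≤ n → f k ≈ 0#) → sumTo n f ≈ 0#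
  sum-zero zero    f f≈0 = f≈0 0 z≤n
  sum-zero (suc n) f f≈0 =
    trans (+-cong (sum-zero n f (λ k k≤n → f≈0 k (m≤n⇒m≤1+n k≤n))) (f≈0 (suc n) ≤-refl))
          (+-identityʳ _)

  sum-last : ∀ l (f : ℕ → Carrier) → (∀ k → k < l → f k ≈ 0#) → sumTo l f ≈ f l
  sum-last zero    f _   = refl
  sum-last (suc l) f f≈0 =
    trans (+-congʳ (sum-zero l f (λ k k≤l → f≈0 k (s≤s k≤l)))) (+-identityˡ _)

  sum-shift : ∀ n l (f : ℕ → Carrier) → (∀ k → k < l → f k ≈ 0#) →
              sumTo (n +ℕ l) f ≈ sumTo n (λ k → f (k +ℕ l))
  sum-shift zero    l f f≈0 = sum-last l f f≈0
  sum-shift (suc n) l f f≈0 = +-congʳ (sum-shift n l f f≈0)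

  module EvenSequence (A : ℕ → Carrier) (even : IsEven A)
                      (l : ℕ) (vanish : ∀ k → k < l → A k ≈ 0#) where

    term : ℕ → ℕ → Carrier
    term m k = ι (m C k) * (sgn k * A k)

    term-vanish : ∀ m k → k < l → term m k ≈ 0#
    term-vanish m k k<l = trans (*-congˡ (trans (*-congˡ (vanish k k<l)) (zeroʳ _))) (zeroʳ _)

    sign-fixes-leading : sgn l * A l ≈ A l
    sign-fixes-leading = begin
      sgn l * A l              ≈⟨ sym (*-identityˡ _) ⟩
      1# * (sgn l * A l)       ≈⟨ *-congʳ (sym (trans (reflexive (≡.cong ι (nCn≡1 l))) ι-1)) ⟩
      term l l                 ≈⟨ sym (sum-last l (term l) (term-vanish l)) ⟩
      sumTo l (term l)         ≈⟨ even l ⟩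
      A l                      ∎

    leading-sign : ¬ (A l ≈ 0#) → sgn l ≈ 1#
    leading-sign = sign-fixing⇒one l sign-fixes-leading

    b : ℕ → Carrier
    b n = A (n +ℕ l) * (rise n l ⁻¹)

    shifted-term : sgn l ≈ 1# → ∀ n k →
      term (n +ℕ l) (k +ℕ l) ≈ rise n l * (ι (n C k) * (sgn k * b k))
    shifted-term sgn≈1 n k = begin
      ι B * (sgn (k +ℕ l) * A (k +ℕ l))
        ≈⟨ *-congˡ (*-cong sgn-shift (sym (cancel-inverse (A (k +ℕ l)) (rise-nonzero k l)))) ⟩
      ι B * (sgn k * (rise k l * b k))        ≈⟨ *-congˡ (x∙yz≈y∙xz _ _ _) ⟩
      ι B * (rise k l * (sgn k * b k))        ≈⟨ sym (*-assoc _ _ _) ⟩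
      (ι B * rise k l) * (sgn k * b k)        ≈⟨ *-congʳ (shifted-binomialF n k l) ⟩
      (rise n l * ι (n C k)) * (sgn k * b k)  ≈⟨ *-assoc _ _ _ ⟩
      rise n l * (ι (n C k) * (sgn k * b k))  ∎
      where
      open import Algebra.Properties.CommutativeSemigroup *-commutativeSemigroup
        using (x∙yz≈y∙xz)
      B = (n +ℕ l) C (k +ℕ l)
      sgn-shift : sgn (k +ℕ l) ≈ sgn k
      sgn-shift = trans (sgn-+ k l) (trans (*-congˡ sgn≈1) (*-identityʳ _))

    shifted-even : sgn l ≈ 1# → IsEven b
    shifted-even sgn≈1 n = sym (begin
      A (n +ℕ l) * (rise n l ⁻¹)
        ≈⟨ *-congʳ A[n+l]≈r*S ⟩
      (rise n l * S) * (rise n l ⁻¹)          ≈⟨ *-assoc _ _ _ ⟩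
      rise n l * (S * (rise n l ⁻¹))          ≈⟨ cancel-inverse S (rise-nonzero n l) ⟩
      S                                       ∎)
      where
      S = sumTo n (λ k → ι (n C k) * (sgn k * b k))
      A[n+l]≈r*S : A (n +ℕ l) ≈ rise n l * S
      A[n+l]≈r*S = begin
        A (n +ℕ l)                              ≈⟨ sym (even (n +ℕ l)) ⟩
        sumTo (n +ℕ l) (term (n +ℕ l))          ≈⟨ sum-shift n l (term (n +ℕ l)) (term-vanish (n +ℕ l)) ⟩
        sumTo n (λ k → term (n +ℕ l) (k +ℕ l))  ≈⟨ sum-cong n (shifted-term sgn≈1 n) ⟩
        sumTo n (λ k → rise n l * (ι (n C k) * (sgn k * b k)))
                                                ≈⟨ sum-*ˡ n (rise n l) _ ⟩
        rise n l * S                            ∎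

-- The theorem: A l ≠ 0 forces (-1)^l = 1, and then the shifted sequence is
-- even.
theorem2p8 : {c ℓ : Level} (F : CharZeroField c ℓ) →
    let open CharZeroField F in
    (A : ℕ → Carrier) → IsEven A →
    (l : ℕ) → 1 ≤ l →
    (∀ k → k < l → A k ≈ 0#) → ¬ (A l ≈ 0#) →
    IsEven (λ n → A (n +ℕ l) * (rise n l ⁻¹))
theorem2p8 F A even l _ vanish A[l]≉0 = shifted-even (leading-sign A[l]≉0)
  where open FieldFacts.EvenSequence F A even l vanish
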